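{- Let $G$ be a connected graph. Then $\tau(B(G))=\min(2\tau(G),1)$.
   Context: All graphs are finite, simple and undirected; $\omega(H)$ denotes the number of connected components of $H$. For a real $t$, a graph $G$ is $t$-tough if $|S|\ge t\,\omega(G-S)$ for every $S\subseteq V(G)$ with $\omega(G-S)>1$. The toughness $\tau(G)$ is the largest $t$ for which $G$ is $t$-tough, with the convention $\tau(K_n)=\infty$ for all $n\ge1$ (and $\min(\infty,1)=1$). For a graph $G$ on vertices $v_1,\dots,v_n$, the bipartite graph $B(G)$ has vertex set $\{v_{i,1},v_{i,2}: i\in[n]\}$; for every $i\in[n]$ the vertices $v_{i,1}$ and $v_{i,2}$ are adjacent, and for every edge $v_iv_j\in E(G)$ the edges $v_{i,1}v_{j,2}$ and $v_{i,2}v_{j,1}$ are present; there are no other edges. -}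

module Defs where

open import Data.Nat using (ℕ; suc; _+_; _<_)
open import Data.Fin using (Fin; splitAt)
open import Data.Fin.Subset using (Subset; _∈_; _∉_; ∣_∣; ⊥)
open import Data.Integer using (+_)
open import Data.Rational using (ℚ; _/_; _*_; _≤_; _⊓_; 1ℚ)
open import Data.Sum using (_⊎_; inj₁; inj₂)
open import Data.Product using (Σ; _×_; ∃; ∃-syntax; _,_)
open import Data.Empty renaming (⊥ to Empty)
open import Relation.Nullary using (¬_)
open import Relation.Binary.PropositionalEquality using (_≡_; refl; sym)
open import Relation.Binary.Construct.Closure.ReflexiveTransitive using (Star)
open import Function.Bundles using (_⇔_)

record Graph (n : ℕ) : Set₁ where
  field
    _~_    : Fin n → Fin n → Set
    ~-sym  : ∀ {u v} → u ~ v → v ~ u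
    ~-irr  : ∀ {v} → ¬ (v ~ v)
open Graph public

Step : ∀ {n} → Graph n → Subset n → Fin n → Fin n → Set
Step G S u v = (u ∉ S) × (v ∉ S) × (_~_ G u v)

Reach : ∀ {n} → Graph n → Subset n → Fin n → Fin n → Set
Reach G S = Star (Step G S)

-- ω(G - S) = k : there is a labelling of the vertices of G - S by Fin k
-- which is onto and identifies exactly the vertices joined by a walk in G - S
-- (i.e. a bijection between the components of G - S and Fin k).
Components : ∀ {n} → Graph n → Subset n → ℕ → Set
Components {n} G S k =
  Σ ((v : Fin n) → v ∉ S → Fin k) λ c →
    (∀ u v (hu : u ∉ S) (hv : v ∉ S) → (c u hu ≡ c v hv) ⇔ Reach G S u v)
    × (∀ (i : Fin k) → ∃[ v ] Σ (v ∉ S) λ hv → c v hv ≡ i)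

Connected : ∀ {n} → Graph n → Set
Connected {n} G = (1 Data.Nat.≤ n) × Components G ⊥ 1

ℕtoℚ : ℕ → ℚ
ℕtoℚ m = + m / 1

Tough : ∀ {n} → Graph n → ℚ → Set
Tough {n} G t = ∀ (S : Subset n) (k : ℕ) → Components G S k → 1 < k →
  t * ℕtoℚ k ≤ ℕtoℚ ∣ S ∣

data ℚ∞ : Set where
  fin : ℚ → ℚ∞
  ∞   : ℚ∞

-- τ(G) = t : t is the largest value for which G is t-tough;
-- τ(G) = ∞ when G is t-tough for every t (the convention for complete graphs).
IsToughness : ∀ {n} → Graph n → ℚ∞ → Set
IsToughness G (fin t) = Tough G t × (∀ t′ → Tough G t′ → t′ ≤ t)
IsToughness G ∞       = ∀ t → Tough G t

min2·1 : ℚ∞ → ℚ∞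
min2·1 (fin t) = fin ((ℕtoℚ 2 * t) ⊓ 1ℚ)
min2·1 ∞       = fin 1ℚ

-- The bipartite graph B(G) on Fin (n + n):
-- v_{i,1} is the vertex with splitAt n _ = inj₁ i, v_{i,2} the one with inj₂ i.
BAdj′ : ∀ {n} → Graph n → Fin n ⊎ Fin n → Fin n ⊎ Fin n → Set
BAdj′ G (inj₁ i) (inj₂ j) = (i ≡ j) ⊎ (_~_ G i j)
BAdj′ G (inj₂ i) (inj₁ j) = (i ≡ j) ⊎ (_~_ G i j)
BAdj′ G (inj₁ i) (inj₁ j) = Empty
BAdj′ G (inj₂ i) (inj₂ j) = Empty

BAdj′-sym : ∀ {n} (G : Graph n) x y → BAdj′ G x y → BAdj′ G y x
BAdj′-sym G (inj₁ i) (inj₂ j) (inj₁ e) = inj₁ (sym e)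
BAdj′-sym G (inj₁ i) (inj₂ j) (inj₂ a) = inj₂ (~-sym G a)
BAdj′-sym G (inj₂ i) (inj₁ j) (inj₁ e) = inj₁ (sym e)
BAdj′-sym G (inj₂ i) (inj₁ j) (inj₂ a) = inj₂ (~-sym G a)

BAdj′-irr : ∀ {n} (G : Graph n) x → ¬ BAdj′ G x x
BAdj′-irr G (inj₁ i) ()
BAdj′-irr G (inj₂ i) ()

B : ∀ {n} → Graph n → Graph (n + n)
B {n} G = record
  { _~_   = λ x y → BAdj′ G (splitAt n x) (splitAt n y)
  ; ~-sym = λ {x} {y} → BAdj′-sym G (splitAt n x) (splitAt n y)
  ; ~-irr = λ {x} → BAdj′-irr G (splitAt n x)
  }

-- Removing both copies of S ⊆ V(G) from B(G) leaves exactly as many components as G − S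
-- has, and removing all first copies leaves n isolated vertices; hence τ(B(G)) ≤ 2τ(G)
-- and τ(B(G)) ≤ 1. Conversely, let T ⊆ V(B(G)), let S be the vertices of G with both
-- copies in T and P those with exactly one, so |T| = 2|S| + |P|. A component of
-- B(G) − T containing a copy of some a ∈ P is determined by a, since the other copy of a
-- lies in T. Any other component contains both copies of every vertex of some component
-- of G − S, and is determined by it. So ω(B(G) − T) ≤ ω(G − S) + |P|, and if G − S is
-- connected and ω(B(G) − T) ≥ 2, every component is of the first kind and
-- ω(B(G) − T) ≤ |P|. Either way t·ω(B(G) − T) ≤ |T| whenever t ≤ min(2τ(G), 1).

module Submission where

open import Defs

module RationalBounds where

  open import Data.Nat as ℕ using (suc; z≤n)
  import Data.Nat.Properties as ℕₚ

  open import Data.Integer using (+_)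
  import Data.Integer as ℤ
  import Data.Integer.Properties as ℤₚ
  open import Data.Rational using (mkℚ; _+_; _*_; _≤_; *≤*; 0ℚ; 1ℚ; ½; NonNegative; Positive; nonNegative)
  open import Data.Rational.Properties
  import Data.Nat.Coprimality as Coprime
  open import Relation.Binary.PropositionalEquality

  private
    ℕtoℚ-mkℚ : ∀ m → ℕtoℚ m ≡ mkℚ (+ m) 0 (Coprime.sym (Coprime.1-coprimeTo m))
    ℕtoℚ-mkℚ m = normalize-coprime (Coprime.sym (Coprime.1-coprimeTo m))

  ℕtoℚ-+ : ∀ a b → ℕtoℚ (a ℕ.+ b) ≡ ℕtoℚ a + ℕtoℚ b
  ℕtoℚ-+ a b rewrite ℕtoℚ-mkℚ a | ℕtoℚ-mkℚ b
    | ℤₚ.*-identityʳ (+ a) | ℤₚ.*-identityʳ (+ b) = refl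

  ℕtoℚ-mono-≤ : ∀ {a b} → a ℕ.≤ b → ℕtoℚ a ≤ ℕtoℚ b
  ℕtoℚ-mono-≤ {a} {b} a≤b rewrite ℕtoℚ-mkℚ a | ℕtoℚ-mkℚ b =
    *≤* (subst₂ ℤ._≤_ (sym (ℤₚ.*-identityʳ (+ a))) (sym (ℤₚ.*-identityʳ (+ b))) (ℤ.+≤+ a≤b))

  ℕtoℚ-nonNeg : ∀ a → NonNegative (ℕtoℚ a)
  ℕtoℚ-nonNeg a rewrite ℕtoℚ-mkℚ a = _

  ℕtoℚ-pos : ∀ a → Positive (ℕtoℚ (suc a))
  ℕtoℚ-pos a rewrite ℕtoℚ-mkℚ (suc a) = _

  2*-double : ∀ x → ℕtoℚ 2 * x ≡ x + x
  2*-double x = trans (*-distribʳ-+ x 1ℚ 1ℚ) (cong₂ _+_ (*-identityˡ x) (*-identityˡ x))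

  ℕtoℚ-double : ∀ a → ℕtoℚ (a ℕ.+ a) ≡ ℕtoℚ 2 * ℕtoℚ a
  ℕtoℚ-double a = trans (ℕtoℚ-+ a a) (sym (2*-double (ℕtoℚ a)))

  open ≤-Reasoning

  *ℕ≤-of-nonPos : ∀ {t} k c → t ≤ 0ℚ → t * ℕtoℚ k ≤ ℕtoℚ c
  *ℕ≤-of-nonPos {t} k c t≤0 = begin
    t * ℕtoℚ k   ≤⟨ *-monoʳ-≤-nonNeg (ℕtoℚ k) ⦃ ℕtoℚ-nonNeg k ⦄ t≤0 ⟩
    0ℚ * ℕtoℚ k  ≡⟨ *-zeroˡ (ℕtoℚ k) ⟩
    0ℚ           ≤⟨ ℕtoℚ-mono-≤ {0} {c} z≤n ⟩
    ℕtoℚ c       ∎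

  *ℕ≤-of-≤1 : ∀ {t} k s p → 0ℚ ≤ t → t ≤ 1ℚ → k ℕ.≤ p →
    t * ℕtoℚ k ≤ ℕtoℚ ((s ℕ.+ s) ℕ.+ p)
  *ℕ≤-of-≤1 {t} k s p 0≤t t≤1 k≤p = begin
    t * ℕtoℚ k    ≤⟨ *-monoˡ-≤-nonNeg t ⦃ nonNegative 0≤t ⦄ (ℕtoℚ-mono-≤ k≤p) ⟩
    t * ℕtoℚ p    ≤⟨ *-monoʳ-≤-nonNeg (ℕtoℚ p) ⦃ ℕtoℚ-nonNeg p ⦄ t≤1 ⟩
    1ℚ * ℕtoℚ p   ≡⟨ *-identityˡ (ℕtoℚ p) ⟩
    ℕtoℚ p        ≤⟨ ℕtoℚ-mono-≤ (ℕₚ.m≤n+m p (s ℕ.+ s)) ⟩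
    ℕtoℚ ((s ℕ.+ s) ℕ.+ p) ∎

  *ℕ≤-of-≤2σ : ∀ {t σ} k m s p → 0ℚ ≤ t → t ≤ ℕtoℚ 2 * σ → t ≤ 1ℚ →
    σ * ℕtoℚ m ≤ ℕtoℚ s → k ℕ.≤ m ℕ.+ p → t * ℕtoℚ k ≤ ℕtoℚ ((s ℕ.+ s) ℕ.+ p)
  *ℕ≤-of-≤2σ {t} {σ} k m s p 0≤t t≤2σ t≤1 σm≤s k≤m+p = begin
    t * ℕtoℚ k                       ≤⟨ *-monoˡ-≤-nonNeg t ⦃ nonNegative 0≤t ⦄ (ℕtoℚ-mono-≤ k≤m+p) ⟩
    t * ℕtoℚ (m ℕ.+ p)               ≡⟨ trans (cong (t *_) (ℕtoℚ-+ m p)) (*-distribˡ-+ t (ℕtoℚ m) (ℕtoℚ p)) ⟩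
    t * ℕtoℚ m + t * ℕtoℚ p          ≤⟨ +-mono-≤ (*-monoʳ-≤-nonNeg (ℕtoℚ m) ⦃ ℕtoℚ-nonNeg m ⦄ t≤2σ)
                                                   (*-monoʳ-≤-nonNeg (ℕtoℚ p) ⦃ ℕtoℚ-nonNeg p ⦄ t≤1) ⟩
    ℕtoℚ 2 * σ * ℕtoℚ m + 1ℚ * ℕtoℚ p ≡⟨ cong₂ _+_ (*-assoc (ℕtoℚ 2) σ (ℕtoℚ m)) (*-identityˡ (ℕtoℚ p)) ⟩
    ℕtoℚ 2 * (σ * ℕtoℚ m) + ℕtoℚ p   ≤⟨ +-monoˡ-≤ (ℕtoℚ p) (*-monoˡ-≤-nonNeg (ℕtoℚ 2) σm≤s) ⟩
    ℕtoℚ 2 * ℕtoℚ s + ℕtoℚ p         ≡⟨ cong (_+ ℕtoℚ p) (sym (ℕtoℚ-double s)) ⟩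
    ℕtoℚ (s ℕ.+ s) + ℕtoℚ p          ≡⟨ sym (ℕtoℚ-+ (s ℕ.+ s) p) ⟩
    ℕtoℚ ((s ℕ.+ s) ℕ.+ p)           ∎

  ½*-≤-of-≤-double : ∀ {t} m s → t * ℕtoℚ m ≤ ℕtoℚ (s ℕ.+ s) → (½ * t) * ℕtoℚ m ≤ ℕtoℚ s
  ½*-≤-of-≤-double {t} m s tm≤2s = begin
    ½ * t * ℕtoℚ m           ≡⟨ *-assoc ½ t (ℕtoℚ m) ⟩
    ½ * (t * ℕtoℚ m)         ≤⟨ *-monoˡ-≤-nonNeg ½ tm≤2s ⟩
    ½ * ℕtoℚ (s ℕ.+ s)       ≡⟨ cong (½ *_) (ℕtoℚ-double s) ⟩
    ½ * (ℕtoℚ 2 * ℕtoℚ s)    ≡⟨ sym (*-assoc ½ (ℕtoℚ 2) (ℕtoℚ s)) ⟩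
    1ℚ * ℕtoℚ s              ≡⟨ *-identityˡ (ℕtoℚ s) ⟩
    ℕtoℚ s                   ∎

  ≤2*-of-½*≤ : ∀ {t τ} → ½ * t ≤ τ → t ≤ ℕtoℚ 2 * τ
  ≤2*-of-½*≤ {t} {τ} ½t≤τ = begin
    t                  ≡⟨ sym (*-identityˡ t) ⟩
    ℕtoℚ 2 * ½ * t     ≡⟨ *-assoc (ℕtoℚ 2) ½ t ⟩
    ℕtoℚ 2 * (½ * t)   ≤⟨ *-monoˡ-≤-nonNeg (ℕtoℚ 2) ½t≤τ ⟩
    ℕtoℚ 2 * τ         ∎

  ≤1-of-*ℕ≤ : ∀ {t} a → t * ℕtoℚ (suc a) ≤ ℕtoℚ (suc a) → t ≤ 1ℚ
  ≤1-of-*ℕ≤ {t} a ta≤a = *-cancelʳ-≤-pos (ℕtoℚ (suc a)) ⦃ ℕtoℚ-pos a ⦄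
    (subst (t * ℕtoℚ (suc a) ≤_) (sym (*-identityˡ _)) ta≤a)


open import Data.Bool using (Bool; true; false; not; _xor_)
open import Data.Empty using (⊥-elim)
open import Data.Fin as Fin using (Fin; zero; suc; _↑ˡ_; _↑ʳ_; splitAt)
import Data.Fin.Properties as Finₚ
open import Data.Fin.Subset using (Subset; _∈_; _∉_; ∣_∣; _∩_; ⊤; inside; outside)
  renaming (⊥ to ∅)
open import Data.Fin.Subset.Properties
  using (_∈?_; ∈⊤; ∉⊥; x∈p∩q⁺; x∈p∩q⁻; ∣⊤∣≡n; ∣⊥∣≡0)
open import Data.Nat using (ℕ; zero; suc; _+_; _≤_; _<_; z≤n; s≤s)
import Data.Nat.Properties as ℕₚ
open import Data.Rational as ℚ using (ℚ; 0ℚ; 1ℚ; ½)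
import Data.Rational.Properties as ℚₚ
open import Data.Product using (Σ; _×_; _,_; proj₁; proj₂; ∃; ∃-syntax)
open import Data.Sum using (_⊎_; inj₁; inj₂; [_,_]′)
import Data.Sum.Properties as Sumₚ
open import Data.Vec as Vec using ([]; _∷_; _++_; zipWith; tabulate; lookup; here; there)
open import Data.Vec.Properties using (lookup⇒[]=; []=⇒lookup; lookup-++ˡ; lookup-++ʳ; lookup∘tabulate)
open import Data.Vec.Properties.WithK using ([]=-irrelevant)
open import Function using (id; _∘_)
open import Function.Bundles using (_⇔_; mk⇔; Equivalence)
open import Relation.Binary.PropositionalEquality
open import Relation.Nullary using (¬_; Dec; yes; no; does; ¬?)
open import Relation.Nullary.Decidable using (dec-true; _×-dec_; _⊎-dec_; map′; decidable-stable; ¬¬-excluded-middle)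
open import Relation.Binary.Structures using (IsEquivalence)
open import Relation.Binary.Construct.Closure.ReflexiveTransitive using (ε; _◅_; _◅◅_; reverse)

open RationalBounds

module _ {m n : ℕ} {p : Subset m} {q : Subset n} where

  x∈p⇒x↑ˡ∈p++q : ∀ {x} → x ∈ p → x ↑ˡ n ∈ p ++ q
  x∈p⇒x↑ˡ∈p++q {x} x∈p = lookup⇒[]= (x ↑ˡ n) (p ++ q) (trans (lookup-++ˡ p q x) ([]=⇒lookup x∈p))

  x↑ˡ∈p++q⇒x∈p : ∀ {x} → x ↑ˡ n ∈ p ++ q → x ∈ p
  x↑ˡ∈p++q⇒x∈p {x} h = lookup⇒[]= x p (trans (sym (lookup-++ˡ p q x)) ([]=⇒lookup h))

  x∈q⇒m↑ʳx∈p++q : ∀ {x} → x ∈ q → m ↑ʳ x ∈ p ++ q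
  x∈q⇒m↑ʳx∈p++q {x} x∈q = lookup⇒[]= (m ↑ʳ x) (p ++ q) (trans (lookup-++ʳ p q x) ([]=⇒lookup x∈q))

  m↑ʳx∈p++q⇒x∈q : ∀ {x} → m ↑ʳ x ∈ p ++ q → x ∈ q
  m↑ʳx∈p++q⇒x∈q {x} h = lookup⇒[]= x q (trans (sym (lookup-++ʳ p q x)) ([]=⇒lookup h))

∣p++q∣≡∣p∣+∣q∣ : ∀ {m n} (p : Subset m) (q : Subset n) → ∣ p ++ q ∣ ≡ ∣ p ∣ + ∣ q ∣
∣p++q∣≡∣p∣+∣q∣ []            q = refl
∣p++q∣≡∣p∣+∣q∣ (inside  ∷ p) q = cong suc (∣p++q∣≡∣p∣+∣q∣ p q)
∣p++q∣≡∣p∣+∣q∣ (outside ∷ p) q = ∣p++q∣≡∣p∣+∣q∣ p q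

_⊕_ : ∀ {n} → Subset n → Subset n → Subset n
_⊕_ = zipWith _xor_

x∈p⊕q⁺ˡ : ∀ {n} {p q : Subset n} {x} → x ∈ p → x ∉ q → x ∈ p ⊕ q
x∈p⊕q⁺ˡ {q = outside ∷ q} here        x∉q = here
x∈p⊕q⁺ˡ {q = inside  ∷ q} here        x∉q = ⊥-elim (x∉q here)
x∈p⊕q⁺ˡ {q = _       ∷ q} (there x∈p) x∉q = there (x∈p⊕q⁺ˡ x∈p (x∉q ∘ there))

x∈p⊕q⁺ʳ : ∀ {n} {p q : Subset n} {x} → x ∉ p → x ∈ q → x ∈ p ⊕ q
x∈p⊕q⁺ʳ {p = outside ∷ p} x∉p here        = here
x∈p⊕q⁺ʳ {p = inside  ∷ p} x∉p here        = ⊥-elim (x∉p here)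
x∈p⊕q⁺ʳ {p = _       ∷ p} x∉p (there x∈q) = there (x∈p⊕q⁺ʳ (x∉p ∘ there) x∈q)

x∈p⊕q⁻ : ∀ {n} (p q : Subset n) {x} → x ∈ p ⊕ q → x ∈ p ⊎ x ∈ q
x∈p⊕q⁻ (inside  ∷ p) (outside ∷ q) here      = inj₁ here
x∈p⊕q⁻ (outside ∷ p) (inside  ∷ q) here      = inj₂ here
x∈p⊕q⁻ (_       ∷ p) (_       ∷ q) (there h) = [ inj₁ ∘ there , inj₂ ∘ there ]′ (x∈p⊕q⁻ p q h)

∣p∣+∣q∣≡2∣p∩q∣+∣p⊕q∣ : ∀ {n} (p q : Subset n) →
  ∣ p ∣ + ∣ q ∣ ≡ (∣ p ∩ q ∣ + ∣ p ∩ q ∣) + ∣ p ⊕ q ∣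
∣p∣+∣q∣≡2∣p∩q∣+∣p⊕q∣ [] [] = refl
∣p∣+∣q∣≡2∣p∩q∣+∣p⊕q∣ (inside ∷ p) (inside ∷ q)
  rewrite ℕₚ.+-suc ∣ p ∣ ∣ q ∣ | ℕₚ.+-suc ∣ p ∩ q ∣ ∣ p ∩ q ∣ =
  cong (2 +_) (∣p∣+∣q∣≡2∣p∩q∣+∣p⊕q∣ p q)
∣p∣+∣q∣≡2∣p∩q∣+∣p⊕q∣ (inside ∷ p) (outside ∷ q)
  rewrite ℕₚ.+-suc (∣ p ∩ q ∣ + ∣ p ∩ q ∣) ∣ p ⊕ q ∣ =
  cong suc (∣p∣+∣q∣≡2∣p∩q∣+∣p⊕q∣ p q)
∣p∣+∣q∣≡2∣p∩q∣+∣p⊕q∣ (outside ∷ p) (inside ∷ q)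
  rewrite ℕₚ.+-suc ∣ p ∣ ∣ q ∣ | ℕₚ.+-suc (∣ p ∩ q ∣ + ∣ p ∩ q ∣) ∣ p ⊕ q ∣ =
  cong suc (∣p∣+∣q∣≡2∣p∩q∣+∣p⊕q∣ p q)
∣p∣+∣q∣≡2∣p∩q∣+∣p⊕q∣ (outside ∷ p) (outside ∷ q) = ∣p∣+∣q∣≡2∣p∩q∣+∣p⊕q∣ p q

module _ {n} {P : Fin n → Set} (P? : ∀ x → Dec (P x)) where

  ∈-tabulate⁺ : ∀ {x} → P x → x ∈ tabulate (does ∘ P?)
  ∈-tabulate⁺ {x} px = lookup⇒[]= x _ (trans (lookup∘tabulate (does ∘ P?) x) (dec-true (P? x) px))

  ∈-tabulate⁻ : ∀ {x} → x ∈ tabulate (does ∘ P?) → P x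
  ∈-tabulate⁻ {x} x∈ with P? x | trans (sym (lookup∘tabulate (does ∘ P?) x)) ([]=⇒lookup x∈)
  ... | yes px | _  = px
  ... | no _   | ()

rank : ∀ {n} (p : Subset n) {x} → x ∈ p → Fin ∣ p ∣
rank (inside  ∷ p) here        = zero
rank (inside  ∷ p) (there x∈p) = suc (rank p x∈p)
rank (outside ∷ p) (there x∈p) = rank p x∈p

rank-injective : ∀ {n} (p : Subset n) {x y} (x∈p : x ∈ p) (y∈p : y ∈ p) →
  rank p x∈p ≡ rank p y∈p → x ≡ y
rank-injective (inside  ∷ p) here        here        _ = refl
rank-injective (inside  ∷ p) (there x∈p) (there y∈p) e =
  cong suc (rank-injective p x∈p y∈p (Finₚ.suc-injective e))
rank-injective (outside ∷ p) (there x∈p) (there y∈p) e = cong suc (rank-injective p x∈p y∈p e)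

rank-cong : ∀ {n} (p : Subset n) {x y} (x∈p : x ∈ p) (y∈p : y ∈ p) → x ≡ y → rank p x∈p ≡ rank p y∈p
rank-cong p x∈p y∈p refl = cong (rank p) ([]=-irrelevant x∈p y∈p)

rank-surjective : ∀ {n} (p : Subset n) (i : Fin ∣ p ∣) → ∃ λ x → Σ (x ∈ p) λ x∈p → rank p x∈p ≡ i
rank-surjective (inside ∷ p) zero = zero , here , refl
rank-surjective (inside ∷ p) (suc i) with rank-surjective p i
... | x , x∈p , e = suc x , there x∈p , cong suc e
rank-surjective (outside ∷ p) i with rank-surjective p i
... | x , x∈p , e = suc x , there x∈p , e

¬¬-Π : ∀ {n} {P : Fin n → Set} → (∀ i → ¬ ¬ P i) → ¬ ¬ (∀ i → P i)
¬¬-Π {zero}  _   ¬∀P = ¬∀P λ ()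
¬¬-Π {suc n} ¬¬P ¬∀P = ¬¬P zero λ P₀ → ¬¬-Π (¬¬P ∘ suc) λ P₊ →
  ¬∀P λ { zero → P₀ ; (suc i) → P₊ i }

least : ∀ {n} {P : Fin n → Set} → (∀ x → Dec (P x)) → ∀ {v} → P v →
  ∃ λ u → P u × (∀ {w} → P w → u Fin.≤ w)
least P? {zero} P₀ = zero , P₀ , λ _ → z≤n
least P? {suc v} Pv with P? zero
... | yes P₀ = zero , P₀ , λ _ → z≤n
... | no ¬P₀ with least (P? ∘ suc) Pv
...   | u , Pu , u-least = suc u , Pu , λ { {zero} P₀ → ⊥-elim (¬P₀ P₀) ; {suc w} Pw → s≤s (u-least Pw) }

-- Components G S m unfolds to ClassLabelling (_∉ S) (Reach G S) m.
ClassLabelling : ∀ {n} (In : Fin n → Set) (R : Fin n → Fin n → Set) → ℕ → Set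
ClassLabelling {n} In R m =
  Σ ((v : Fin n) → In v → Fin m) λ c →
    (∀ u v (hu : In u) (hv : In v) → (c u hu ≡ c v hv) ⇔ R u v)
    × (∀ (i : Fin m) → ∃[ v ] Σ (In v) λ hv → c v hv ≡ i)

module _ {n} {In : Fin n → Set} {R : Fin n → Fin n → Set}
         (In? : ∀ v → Dec (In v)) (R? : ∀ u v → Dec (R u v)) (R-equiv : IsEquivalence R) where

  open IsEquivalence R-equiv renaming (refl to R-refl; sym to R-sym; trans to R-trans)

  -- A class is labelled by the rank of its least element among all least elements.

  private
    least-in-class : ∀ v → In v → ∃ λ u → (In u × R u v) × (∀ {w} → In w × R w v → u Fin.≤ w)
    least-in-class v hv = least (λ u → In? u ×-dec R? u v) (hv , R-refl)

    rep : ∀ v → In v → Fin n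
    rep v hv = proj₁ (least-in-class v hv)

    rep-in : ∀ v hv → In (rep v hv)
    rep-in v hv = proj₁ (proj₁ (proj₂ (least-in-class v hv)))

    rep-related : ∀ v hv → R (rep v hv) v
    rep-related v hv = proj₂ (proj₁ (proj₂ (least-in-class v hv)))

    rep-least : ∀ v hv {w} → In w × R w v → rep v hv Fin.≤ w
    rep-least v hv = proj₂ (proj₂ (least-in-class v hv))

    rep-cong : ∀ {u v} hu hv → R u v → rep u hu ≡ rep v hv
    rep-cong {u} {v} hu hv uRv = Finₚ.≤-antisym
      (rep-least u hu (rep-in v hv , R-trans (rep-related v hv) (R-sym uRv)))
      (rep-least v hv (rep-in u hu , R-trans (rep-related u hu) uRv))

    IsRep : Fin n → Set
    IsRep u = Σ (In u) λ hu → rep u hu ≡ u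

    IsRep? : ∀ u → Dec (IsRep u)
    IsRep? u with In? u
    ... | no ¬hu = no (¬hu ∘ proj₁)
    ... | yes hu = map′ (hu ,_) (λ (hu′ , e) → trans (rep-cong hu hu′ R-refl) e) (rep u hu Fin.≟ u)

    reps : Subset n
    reps = tabulate (does ∘ IsRep?)

    rep∈reps : ∀ v hv → rep v hv ∈ reps
    rep∈reps v hv = ∈-tabulate⁺ IsRep? (rep-in v hv , rep-cong _ hv (rep-related v hv))

    label : (v : Fin n) → In v → Fin ∣ reps ∣
    label v hv = rank reps (rep∈reps v hv)

    label-≡⇔R : ∀ u v hu hv → (label u hu ≡ label v hv) ⇔ R u v
    label-≡⇔R u v hu hv = mk⇔
      (λ e → let rep-u≡rep-v = rank-injective reps _ _ e in
        R-trans (R-sym (rep-related u hu)) (subst (λ w → R w v) (sym rep-u≡rep-v) (rep-related v hv)))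
      (λ uRv → rank-cong reps _ _ (rep-cong hu hv uRv))

    label-surjective : ∀ i → ∃[ v ] Σ (In v) λ hv → label v hv ≡ i
    label-surjective i with rank-surjective reps i
    ... | u , u∈reps , e with ∈-tabulate⁻ IsRep? u∈reps
    ...   | hu , rep-u≡u = u , hu , trans (rank-cong reps _ _ rep-u≡u) e

  classLabelling : ∃ (ClassLabelling In R)
  classLabelling = ∣ reps ∣ , label , label-≡⇔R , label-surjective

module _ {n} {G : Graph n} {S : Subset n} where

  Step-sym : ∀ {u v} → Step G S u v → Step G S v u
  Step-sym (hu , hv , u~v) = hv , hu , ~-sym G u~v

  Reach-isEquivalence : IsEquivalence (Reach G S)
  Reach-isEquivalence = record { refl = ε ; sym = reverse Step-sym ; trans = _◅◅_ }

  -- Adjacency is not decidable, so the components of G − S exist only up to double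
  -- negation; this suffices because the goal, an inequality of rationals, is decidable.
  ¬¬-components : ¬ ¬ ∃ (Components G S)
  ¬¬-components ∄comp = ¬¬-Π (λ u → ¬¬-Π (λ v → ¬¬-excluded-middle)) λ Reach? →
    ∄comp (classLabelling (λ v → ¬? (v ∈? S)) Reach? Reach-isEquivalence)

module ComponentLabel {n} (G : Graph n) (S : Subset n) {k} (comp : Components G S k) where

  label : (v : Fin n) → v ∉ S → Fin k
  label = proj₁ comp

  reach⇒same-label : ∀ {u v} hu hv → Reach G S u v → label u hu ≡ label v hv
  reach⇒same-label hu hv = Equivalence.from (proj₁ (proj₂ comp) _ _ hu hv)

  same-label⇒reach : ∀ {u v} hu hv → label u hu ≡ label v hv → Reach G S u v
  same-label⇒reach hu hv = Equivalence.to (proj₁ (proj₂ comp) _ _ hu hv)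

  adjacent⇒same-label : ∀ {u v} hu hv → _~_ G u v → label u hu ≡ label v hv
  adjacent⇒same-label hu hv u~v = reach⇒same-label hu hv ((hu , hv , u~v) ◅ ε)

  label-cong : ∀ {u v} hu hv → u ≡ v → label u hu ≡ label v hv
  label-cong hu hv refl = reach⇒same-label hu hv ε

  label-surjective : ∀ i → ∃[ v ] Σ (v ∉ S) λ hv → label v hv ≡ i
  label-surjective = proj₂ (proj₂ comp)

module BipartiteDouble {n} (G : Graph n) where

  _≡∨~_ : Fin n → Fin n → Set
  a ≡∨~ b = a ≡ b ⊎ _~_ G a b

  -- ⟨ false , a ⟩ and ⟨ true , a ⟩ are the vertices v_{a,1} and v_{a,2} of B(G).
  ⟨_,_⟩ : Bool → Fin n → Fin (n + n)
  ⟨ false , a ⟩ = a ↑ˡ n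
  ⟨ true  , a ⟩ = n ↑ʳ a

  data Copy : Fin (n + n) → Set where
    copy : ∀ s a → Copy ⟨ s , a ⟩

  copy-view : ∀ x → Copy x
  copy-view x with splitAt n x in eq
  ... | inj₁ a = subst Copy (Finₚ.splitAt⁻¹-↑ˡ eq) (copy false a)
  ... | inj₂ a = subst Copy (Finₚ.splitAt⁻¹-↑ʳ eq) (copy true a)

  base : Fin (n + n) → Fin n
  base x = [ id , id ]′ (splitAt n x)

  base-⟨⟩ : ∀ s a → base ⟨ s , a ⟩ ≡ a
  base-⟨⟩ false a = cong [ id , id ]′ (Finₚ.splitAt-↑ˡ n a n)
  base-⟨⟩ true  a = cong [ id , id ]′ (Finₚ.splitAt-↑ʳ n n a)

  ⟨⟩-adjacent : ∀ s {a b} → a ≡∨~ b → _~_ (B G) ⟨ s , a ⟩ ⟨ not s , b ⟩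
  ⟨⟩-adjacent false {a} {b} a≡∨~b
    rewrite Finₚ.splitAt-↑ˡ n a n | Finₚ.splitAt-↑ʳ n n b = a≡∨~b
  ⟨⟩-adjacent true {a} {b} a≡∨~b
    rewrite Finₚ.splitAt-↑ʳ n n a | Finₚ.splitAt-↑ˡ n b n = a≡∨~b

  ⟨⟩-adjacent⁻¹ : ∀ s s′ {a b} → _~_ (B G) ⟨ s , a ⟩ ⟨ s′ , b ⟩ → s′ ≡ not s × a ≡∨~ b
  ⟨⟩-adjacent⁻¹ false false {a} {b} a~b
    rewrite Finₚ.splitAt-↑ˡ n a n | Finₚ.splitAt-↑ˡ n b n = ⊥-elim a~b
  ⟨⟩-adjacent⁻¹ false true {a} {b} a~b
    rewrite Finₚ.splitAt-↑ˡ n a n | Finₚ.splitAt-↑ʳ n n b = refl , a~b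
  ⟨⟩-adjacent⁻¹ true false {a} {b} a~b
    rewrite Finₚ.splitAt-↑ʳ n n a | Finₚ.splitAt-↑ˡ n b n = refl , a~b
  ⟨⟩-adjacent⁻¹ true true {a} {b} a~b
    rewrite Finₚ.splitAt-↑ʳ n n a | Finₚ.splitAt-↑ʳ n n b = ⊥-elim a~b

  half : Bool → Subset n → Subset n → Subset n
  half false X Y = X
  half true  X Y = Y

  ⟨⟩∈++⁺ : ∀ s {a} {X Y : Subset n} → a ∈ half s X Y → ⟨ s , a ⟩ ∈ X ++ Y
  ⟨⟩∈++⁺ false = x∈p⇒x↑ˡ∈p++q
  ⟨⟩∈++⁺ true  = x∈q⇒m↑ʳx∈p++q

  ⟨⟩∈++⁻ : ∀ s {a} {X Y : Subset n} → ⟨ s , a ⟩ ∈ X ++ Y → a ∈ half s X Y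
  ⟨⟩∈++⁻ false = x↑ˡ∈p++q⇒x∈p
  ⟨⟩∈++⁻ true  = m↑ʳx∈p++q⇒x∈q

  ∩⇒∈half : ∀ s {a} {X Y : Subset n} → a ∈ X ∩ Y → a ∈ half s X Y
  ∩⇒∈half false a∈X∩Y = proj₁ (x∈p∩q⁻ _ _ a∈X∩Y)
  ∩⇒∈half true  a∈X∩Y = proj₂ (x∈p∩q⁻ _ _ a∈X∩Y)

  ∈halves⇒∈∩ : ∀ s {a} {X Y : Subset n} → a ∈ half s X Y → a ∈ half (not s) X Y → a ∈ X ∩ Y
  ∈halves⇒∈∩ false a∈X a∈Y = x∈p∩q⁺ (a∈X , a∈Y)
  ∈halves⇒∈∩ true  a∈Y a∈X = x∈p∩q⁺ (a∈X , a∈Y)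

  ∈one-half⇒∈⊕ : ∀ s {a} {X Y : Subset n} → a ∉ half s X Y → a ∈ half (not s) X Y → a ∈ X ⊕ Y
  ∈one-half⇒∈⊕ false a∉X a∈Y = x∈p⊕q⁺ʳ a∉X a∈Y
  ∈one-half⇒∈⊕ true  a∉Y a∈X = x∈p⊕q⁺ˡ a∈X a∉Y

  ∈⊕⇒∈other-half : ∀ s {a} {X Y : Subset n} → a ∈ X ⊕ Y → a ∉ half s X Y → a ∈ half (not s) X Y
  ∈⊕⇒∈other-half false {X = X} {Y} a∈X⊕Y a∉X = [ ⊥-elim ∘ a∉X , id ]′ (x∈p⊕q⁻ X Y a∈X⊕Y)
  ∈⊕⇒∈other-half true  {X = X} {Y} a∈X⊕Y a∉Y = [ id , ⊥-elim ∘ a∉Y ]′ (x∈p⊕q⁻ X Y a∈X⊕Y)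

  module BothCopiesRemoved (S : Subset n) where

    ⟨⟩∉S++S : ∀ s {a} → a ∉ S → ⟨ s , a ⟩ ∉ S ++ S
    ⟨⟩∉S++S false a∉S = a∉S ∘ ⟨⟩∈++⁻ false
    ⟨⟩∉S++S true  a∉S = a∉S ∘ ⟨⟩∈++⁻ true

    ⟨⟩∉S++S⁻¹ : ∀ s {a} → ⟨ s , a ⟩ ∉ S ++ S → a ∉ S
    ⟨⟩∉S++S⁻¹ false h = h ∘ ⟨⟩∈++⁺ false
    ⟨⟩∉S++S⁻¹ true  h = h ∘ ⟨⟩∈++⁺ true

    base∉S : ∀ {x} → x ∉ S ++ S → base x ∉ S
    base∉S {x} h with copy-view x
    ... | copy s a = subst (_∉ S) (sym (base-⟨⟩ s a)) (⟨⟩∉S++S⁻¹ s h)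

    twin-reach : ∀ s s′ {a} → a ∉ S → Reach (B G) (S ++ S) ⟨ s , a ⟩ ⟨ s′ , a ⟩
    twin-reach false false a∉S = ε
    twin-reach true  true  a∉S = ε
    twin-reach false true  a∉S =
      (⟨⟩∉S++S false a∉S , ⟨⟩∉S++S true a∉S , ⟨⟩-adjacent false (inj₁ refl)) ◅ ε
    twin-reach true  false a∉S =
      (⟨⟩∉S++S true a∉S , ⟨⟩∉S++S false a∉S , ⟨⟩-adjacent true (inj₁ refl)) ◅ ε

    lift : ∀ s s′ {a b} → a ∉ S → Reach G S a b → Reach (B G) (S ++ S) ⟨ s , a ⟩ ⟨ s′ , b ⟩
    lift s s′ a∉S ε = twin-reach s s′ a∉S
    lift s s′ a∉S ((_ , c∉S , a~c) ◅ walk) =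
      (⟨⟩∉S++S s a∉S , ⟨⟩∉S++S (not s) c∉S , ⟨⟩-adjacent s (inj₂ a~c))
        ◅ lift (not s) s′ c∉S walk

    project-step : ∀ {x y} → Step (B G) (S ++ S) x y → Reach G S (base x) (base y)
    project-step {x} {y} (hx , hy , x~y) with copy-view x | copy-view y
    ... | copy s a | copy s′ b rewrite base-⟨⟩ s a | base-⟨⟩ s′ b with proj₂ (⟨⟩-adjacent⁻¹ s s′ x~y)
    ...   | inj₁ refl = ε
    ...   | inj₂ a~b  = (⟨⟩∉S++S⁻¹ s hx , ⟨⟩∉S++S⁻¹ s′ hy , a~b) ◅ ε

    project : ∀ {x y} → Reach (B G) (S ++ S) x y → Reach G S (base x) (base y)
    project ε             = ε
    project (step ◅ walk) = project-step step ◅◅ project walk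

    components : ∀ {m} → Components G S m → Components (B G) (S ++ S) m
    components {m} comp = labelB , (λ x y hx hy → mk⇔ (to hx hy) (from hx hy)) , surjective
      where
      open ComponentLabel G S comp

      labelB : (x : Fin (n + n)) → x ∉ S ++ S → Fin m
      labelB x hx = label (base x) (base∉S hx)

      to : ∀ {x y} hx hy → labelB x hx ≡ labelB y hy → Reach (B G) (S ++ S) x y
      to {x} {y} hx hy e with copy-view x | copy-view y
      ... | copy s a | copy s′ b = lift s s′ (⟨⟩∉S++S⁻¹ s hx)
        (subst₂ (Reach G S) (base-⟨⟩ s a) (base-⟨⟩ s′ b) (same-label⇒reach _ _ e))

      from : ∀ {x y} hx hy → Reach (B G) (S ++ S) x y → labelB x hx ≡ labelB y hy
      from hx hy walk = reach⇒same-label _ _ (project walk)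

      surjective : ∀ i → ∃[ x ] Σ (x ∉ S ++ S) λ hx → labelB x hx ≡ i
      surjective i with label-surjective i
      ... | a , a∉S , e = ⟨ false , a ⟩ , ⟨⟩∉S++S false a∉S , trans (label-cong _ _ (base-⟨⟩ false a)) e

  firstCopies : Subset (n + n)
  firstCopies = ⊤ {n} ++ ∅ {n}

  ∣firstCopies∣ : ∣ firstCopies ∣ ≡ n
  ∣firstCopies∣ = trans (∣p++q∣≡∣p∣+∣q∣ (⊤ {n}) (∅ {n}))
    (trans (cong₂ _+_ (∣⊤∣≡n n) (∣⊥∣≡0 n)) (ℕₚ.+-identityʳ n))

  ∉firstCopies⇒second : ∀ {x} → x ∉ firstCopies → ∃ λ a → x ≡ ⟨ true , a ⟩
  ∉firstCopies⇒second {x} h with copy-view x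
  ... | copy false a = ⊥-elim (h (⟨⟩∈++⁺ false {a} {⊤} ∈⊤))
  ... | copy true  a = a , refl

  ¬Step-firstCopies : ∀ {x y} → ¬ Step (B G) firstCopies x y
  ¬Step-firstCopies {x} {y} (hx , hy , x~y) with ∉firstCopies⇒second {x} hx | ∉firstCopies⇒second {y} hy
  ... | a , refl | b , refl with proj₁ (⟨⟩-adjacent⁻¹ true true x~y)
  ...   | ()

  components-firstCopies : Components (B G) firstCopies n
  components-firstCopies = (λ x _ → base x) , (λ x y hx hy → mk⇔ (to hx hy) (from hx hy)) , surjective
    where
    to : ∀ {x y} hx hy → base x ≡ base y → Reach (B G) firstCopies x y
    to {x} {y} hx hy e with ∉firstCopies⇒second {x} hx | ∉firstCopies⇒second {y} hy
    ... | a , refl | b , refl with trans (sym (base-⟨⟩ true a)) (trans e (base-⟨⟩ true b))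
    ...   | refl = ε

    from : ∀ {x y} hx hy → Reach (B G) firstCopies x y → base x ≡ base y
    from hx hy ε          = refl
    from hx hy (step ◅ _) = ⊥-elim (¬Step-firstCopies step)

    surjective : ∀ a → ∃[ x ] Σ (x ∉ firstCopies) λ hx → base x ≡ a
    surjective a = ⟨ true , a ⟩ , ∉⊥ ∘ ⟨⟩∈++⁻ true {a} {⊤} , base-⟨⟩ true a

B-tough⇒≤1 : ∀ {n} (G : Graph n) → 2 ≤ n → ∀ {t} → Tough (B G) t → t ℚ.≤ 1ℚ
B-tough⇒≤1 {suc (suc n)} G (s≤s (s≤s z≤n)) {t} t-tough = ≤1-of-*ℕ≤ (suc n)
  (subst (λ c → t ℚ.* ℕtoℚ (suc (suc n)) ℚ.≤ ℕtoℚ c) ∣firstCopies∣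
    (t-tough firstCopies _ components-firstCopies (s≤s (s≤s z≤n))))
  where open BipartiteDouble G

B-tough⇒½-tough : ∀ {n} (G : Graph n) {t} → Tough (B G) t → Tough G (½ ℚ.* t)
B-tough⇒½-tough G {t} t-tough S m comp 1<m = ½*-≤-of-≤-double {t} m ∣ S ∣
  (subst (λ c → t ℚ.* ℕtoℚ m ℚ.≤ ℕtoℚ c) (∣p++q∣≡∣p∣+∣q∣ S S)
    (t-tough (S ++ S) m (components comp) 1<m))
  where open BipartiteDouble.BothCopiesRemoved G S

module Cut {n} (G : Graph n) (X Y : Subset n) {k} (compB : Components (B G) (X ++ Y) k) where

  open BipartiteDouble G
  module LB = ComponentLabel (B G) (X ++ Y) compB

  T : Subset (n + n)
  T = X ++ Y

  S : Subset n
  S = X ∩ Y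

  P : Subset n
  P = X ⊕ Y

  ∣T∣≡2∣S∣+∣P∣ : ∣ T ∣ ≡ (∣ S ∣ + ∣ S ∣) + ∣ P ∣
  ∣T∣≡2∣S∣+∣P∣ = trans (∣p++q∣≡∣p∣+∣q∣ X Y) (∣p∣+∣q∣≡2∣p∩q∣+∣p⊕q∣ X Y)

  ⟨⟩∉T⇒∉S : ∀ s {a} → ⟨ s , a ⟩ ∉ T → a ∉ S
  ⟨⟩∉T⇒∉S s h = h ∘ ⟨⟩∈++⁺ s ∘ ∩⇒∈half s

  ∉S⇒twin∉T : ∀ s {a} → a ∉ S → ⟨ s , a ⟩ ∈ T → ⟨ not s , a ⟩ ∉ T
  ∉S⇒twin∉T s a∉S h h′ = a∉S (∈halves⇒∈∩ s (⟨⟩∈++⁻ s h) (⟨⟩∈++⁻ (not s) h′))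

  twin∈T⇒∈P : ∀ s {a} → ⟨ s , a ⟩ ∉ T → ⟨ not s , a ⟩ ∈ T → a ∈ P
  twin∈T⇒∈P s h h′ = ∈one-half⇒∈⊕ s (h ∘ ⟨⟩∈++⁺ s) (⟨⟩∈++⁻ (not s) h′)

  ∈P⇒twin∈T : ∀ s {a} → a ∈ P → ⟨ s , a ⟩ ∉ T → ⟨ not s , a ⟩ ∈ T
  ∈P⇒twin∈T s a∈P h = ⟨⟩∈++⁺ (not s) (∈⊕⇒∈other-half s a∈P (h ∘ ⟨⟩∈++⁺ s))

  some-copy∉T : ∀ {a} → a ∉ S → ∃ λ s → ⟨ s , a ⟩ ∉ T
  some-copy∉T {a} a∉S with ⟨ false , a ⟩ ∈? T
  ... | no  h = false , h
  ... | yes h = true , ∉S⇒twin∉T false a∉S h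

  InComponent : Bool → Fin n → Fin k → Set
  InComponent s a i = Σ (⟨ s , a ⟩ ∉ T) λ h → LB.label ⟨ s , a ⟩ h ≡ i

  InComponent? : ∀ s a i → Dec (InComponent s a i)
  InComponent? s a i with ⟨ s , a ⟩ ∈? T
  ... | yes h = no λ (h′ , _) → h′ h
  ... | no  h = map′ (h ,_) (λ (h′ , e) → trans (LB.label-cong h h′ refl) e) (LB.label ⟨ s , a ⟩ h Fin.≟ i)

  copy-in : ∀ i → ∃ λ s → ∃ λ a → InComponent s a i
  copy-in i with LB.label-surjective i
  ... | x , hx , e with copy-view x
  ...   | copy s a = s , a , hx , e

  Boundary : Fin k → Set
  Boundary i = ∃ λ a → a ∈ P × ∃ λ s → InComponent s a i

  Boundary? : ∀ i → Dec (Boundary i)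
  Boundary? i = Finₚ.any? λ a → (a ∈? P) ×-dec
    map′ (λ { (inj₁ c) → false , c ; (inj₂ c) → true , c })
         (λ { (false , c) → inj₁ c ; (true , c) → inj₂ c })
         (InComponent? false a i ⊎-dec InComponent? true a i)

  boundary-index : ∀ {i} → Boundary i → Fin ∣ P ∣
  boundary-index (_ , a∈P , _) = rank P a∈P

  ∈P⇒unique-copy∉T : ∀ s s′ {a} → a ∈ P → ⟨ s , a ⟩ ∉ T → ⟨ s′ , a ⟩ ∉ T → s ≡ s′
  ∈P⇒unique-copy∉T false false a∈P h h′ = refl
  ∈P⇒unique-copy∉T true  true  a∈P h h′ = refl
  ∈P⇒unique-copy∉T false true  a∈P h h′ = ⊥-elim (h′ (∈P⇒twin∈T false a∈P h))
  ∈P⇒unique-copy∉T true  false a∈P h h′ = ⊥-elim (h′ (∈P⇒twin∈T true a∈P h))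

  boundary-index-injective : ∀ {i j} (bi : Boundary i) (bj : Boundary j) →
    boundary-index bi ≡ boundary-index bj → i ≡ j
  boundary-index-injective (a , a∈P , s , h , e) (b , b∈P , s′ , h′ , e′) same
    with rank-injective P a∈P b∈P same
  ... | refl with ∈P⇒unique-copy∉T s s′ a∈P h h′
  ...   | refl = trans (sym e) (trans (LB.label-cong h h′ refl) e′)

  Absorbs : Fin k → Fin n → Set
  Absorbs i a = ∀ s → InComponent s a i

  module _ {i} (¬boundary : ¬ Boundary i) where

    twin-in-component : ∀ s {a} → InComponent s a i → InComponent (not s) a i
    twin-in-component s {a} (h , e) with ⟨ not s , a ⟩ ∈? T
    ... | yes h′ = ⊥-elim (¬boundary (a , twin∈T⇒∈P s h h′ , s , h , e))
    ... | no  h′ = h′ , trans (sym (LB.adjacent⇒same-label h h′ (⟨⟩-adjacent s (inj₁ refl)))) e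

    absorbs : ∀ s {a} → InComponent s a i → Absorbs i a
    absorbs false c false = c
    absorbs false c true  = twin-in-component false c
    absorbs true  c false = twin-in-component true c
    absorbs true  c true  = c

    absorbs-step : ∀ {a b} → Absorbs i a → Step G S a b → Absorbs i b
    absorbs-step a-absorbed (_ , b∉S , a~b) with some-copy∉T b∉S
    ... | s , h with a-absorbed (not s)
    ...   | h′ , e = absorbs s (h , trans (LB.adjacent⇒same-label h h′ (⟨⟩-adjacent s (inj₂ (~-sym G a~b)))) e)

    absorbs-walk : ∀ {a b} → Absorbs i a → Reach G S a b → Absorbs i b
    absorbs-walk a-absorbed ε             = a-absorbed
    absorbs-walk a-absorbed (step ◅ walk) = absorbs-walk (absorbs-step a-absorbed step) walk

  module _ {m} (compG : Components G S m) where

    module LG = ComponentLabel G S compG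

    G-component : Fin k → Fin m
    G-component i = let (s , a , h , _) = copy-in i in LG.label a (⟨⟩∉T⇒∉S s h)

    non-boundary-determined : ∀ {i j} → ¬ Boundary i → G-component i ≡ G-component j → i ≡ j
    non-boundary-determined {i} {j} ¬bi same =
      let (s , a , h , e) = copy-in i
          (s′ , b , h′ , e′) = copy-in j
          (h″ , e″) = absorbs-walk ¬bi (absorbs ¬bi s (h , e)) (LG.same-label⇒reach _ _ same) s′
      in trans (sym e″) (trans (LB.label-cong h″ h′ refl) e′)

    index : ∀ i → Dec (Boundary i) → Fin m ⊎ Fin ∣ P ∣
    index i (yes bi) = inj₂ (boundary-index bi)
    index i (no _)   = inj₁ (G-component i)

    index-injective : ∀ {i j} di dj → index i di ≡ index j dj → i ≡ j
    index-injective (yes bi)  (yes bj) e = boundary-index-injective bi bj (Sumₚ.inj₂-injective e)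
    index-injective (no ¬bi)  (no _)   e = non-boundary-determined ¬bi (Sumₚ.inj₁-injective e)
    index-injective (yes _)   (no _)   ()
    index-injective (no _)    (yes _)  ()

    k≤m+∣P∣ : k ≤ m + ∣ P ∣
    k≤m+∣P∣ = Finₚ.injective⇒≤ λ {i} {j} e → index-injective (Boundary? i) (Boundary? j)
      (trans (sym (Finₚ.splitAt-join m ∣ P ∣ _)) (trans (cong (splitAt m) e) (Finₚ.splitAt-join m ∣ P ∣ _)))

  another : 1 < k → (i : Fin k) → ∃ λ j → j ≢ i
  another (s≤s (s≤s _)) zero    = suc zero , λ ()
  another (s≤s (s≤s _)) (suc i) = zero , λ ()

  module _ (compG : Components G S 1) (1<k : 1 < k) where

    boundary : ∀ i → Boundary i
    boundary i = decidable-stable (Boundary? i) λ ¬bi →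
      let (j , j≢i) = another 1<k i in j≢i (sym (non-boundary-determined compG ¬bi (Fin1-≡ _ _)))
      where
      Fin1-≡ : (x y : Fin 1) → x ≡ y
      Fin1-≡ zero zero = refl

    k≤∣P∣ : k ≤ ∣ P ∣
    k≤∣P∣ = Finₚ.injective⇒≤ λ {i} {j} → boundary-index-injective (boundary i) (boundary j)

  t*k≤∣T∣ : ∀ {σ t m} → Tough G σ → 0ℚ ℚ.≤ t → t ℚ.≤ ℕtoℚ 2 ℚ.* σ → t ℚ.≤ 1ℚ → 1 < k →
    Components G S m → t ℚ.* ℕtoℚ k ℚ.≤ ℕtoℚ ∣ T ∣
  t*k≤∣T∣ {m = zero} _ _ _ _ (s≤s (s≤s _)) compG = ⊥-elim (Finₚ.¬Fin0 (G-component compG zero))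
  t*k≤∣T∣ {t = t} {m = suc zero} _ 0≤t _ t≤1 1<k compG =
    subst (λ c → t ℚ.* ℕtoℚ k ℚ.≤ ℕtoℚ c) (sym ∣T∣≡2∣S∣+∣P∣)
      (*ℕ≤-of-≤1 {t} k ∣ S ∣ ∣ P ∣ 0≤t t≤1 (k≤∣P∣ compG 1<k))
  t*k≤∣T∣ {σ} {t} {suc (suc m)} σ-tough 0≤t t≤2σ t≤1 _ compG =
    subst (λ c → t ℚ.* ℕtoℚ k ℚ.≤ ℕtoℚ c) (sym ∣T∣≡2∣S∣+∣P∣)
      (*ℕ≤-of-≤2σ {t} {σ} k _ ∣ S ∣ ∣ P ∣ 0≤t t≤2σ t≤1
        (σ-tough S _ compG (s≤s (s≤s z≤n))) (k≤m+∣P∣ compG))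

tough⇒B-tough : ∀ {n} (G : Graph n) {σ t} → Tough G σ → t ℚ.≤ ℕtoℚ 2 ℚ.* σ → t ℚ.≤ 1ℚ →
  Tough (B G) t
tough⇒B-tough {n} G {σ} {t} σ-tough t≤2σ t≤1 T k compB 1<k with Vec.splitAt n T | t ℚₚ.≤? 0ℚ
... | X , Y , refl | yes t≤0 = *ℕ≤-of-nonPos {t} k ∣ X ++ Y ∣ t≤0
... | X , Y , refl | no t≰0 =
  decidable-stable (t ℚ.* ℕtoℚ k ℚₚ.≤? ℕtoℚ ∣ X ++ Y ∣) λ ¬bound →
    ¬¬-components {G = G} {S = X ∩ Y} λ (m , compG) →
      ¬bound (Cut.t*k≤∣T∣ G X Y compB {σ} {t} σ-tough (ℚₚ.<⇒≤ (ℚₚ.≰⇒> t≰0)) t≤2σ t≤1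
                1<k compG)

claim4p1 : ∀ {n : ℕ} (G : Graph n) → 2 ≤ n → Connected G →
    ∀ (τ : ℚ∞) → IsToughness G τ → IsToughness (B G) (min2·1 τ)
claim4p1 G 2≤n _ (fin τ) (τ-tough , τ-max) =
  tough⇒B-tough G {τ} τ-tough (ℚₚ.p⊓q≤p (ℕtoℚ 2 ℚ.* τ) 1ℚ) (ℚₚ.p⊓q≤q (ℕtoℚ 2 ℚ.* τ) 1ℚ) ,
  λ t t-tough → ℚₚ.⊓-glb (≤2*-of-½*≤ {t} (τ-max (½ ℚ.* t) (B-tough⇒½-tough G {t} t-tough)))
                          (B-tough⇒≤1 G 2≤n t-tough)
claim4p1 G 2≤n _ ∞ all-tough =
  tough⇒B-tough G {½} {1ℚ} (all-tough ½) ℚₚ.≤-refl ℚₚ.≤-refl , λ t → B-tough⇒≤1 G 2≤n
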